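{- For all non-negative integers $n$ and $j\in\{0,1\}$, \[T_{2(n+1)+j}^2=1+\sum_{k=1}^n\left\{T_{2k+j+1}^2+2T_{2k+j}^2+9T_{2k+j-1}^2+4\sum_{i=0}^{2k+j-4}(T_{2k+j-i}+T_{2k+j-i-1})T_{i+2}^2\right\}.\]
   Context: Tribonacci numbers: $T_n=T_{n-1}+T_{n-2}+T_{n-3}+\delta_{n,2}$ for all integers $n$, with $T_n=0$ for $n<2$; $\delta_{i,j}$ is $1$ if $i=j$ and $0$ otherwise. Empty sums are zero. -}

module Defs where

open import Data.Nat using (ℕ; zero; suc; _+_)

-- Tribonacci numbers T_n for n ≥ 0: T_0 = T_1 = 0, T_2 = 1,
-- T_{n+3} = T_{n+2} + T_{n+1} + T_n  (the context's recurrence restricted to n ≥ 0;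
-- T_n = 0 for n < 2 and the δ term only contributes at n = 2).
T : ℕ → ℕ
T 0 = 0
T 1 = 0
T 2 = 1
T (suc (suc (suc n))) = T (suc (suc n)) + T (suc n) + T n

Σ< : ℕ → (ℕ → ℕ) → ℕ
Σ< zero f = 0
Σ< (suc n) f = Σ< n f + f n

Σ1to : ℕ → (ℕ → ℕ) → ℕ
Σ1to zero f = 0
Σ1to (suc n) f = Σ1to n f + f (suc n)

{-# OPTIONS --safe #-}
module Submission where

-- The summand for index k is exactly T(m+2)² − T(m)² with m = 2k + j, so the sum telescopes
-- along m ≡ j (mod 2) down to T(2+j)² = 1.  To prove the one-step identity, write the inner sum
-- through the convolutions conv c p = Σ_{i<p} T(c+p−i) T(i+2)²: the Tribonacci recurrence in the
-- first factor gives conv 4 = conv 3 + conv 2 + conv 1, and peeling off the last term gives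
-- conv c (p+1) = conv (c+1) p + T(c+1) T(p+2)².  Hence 2·conv 1, 2·conv 2 and 2·conv 3 have
-- quadratic closed forms in T p, T(p+1), T(p+2), proved jointly by induction on p, after which
-- the one-step identity is a polynomial identity.

open import Defs
open import Data.Nat using (ℕ; zero; suc; _+_; _*_; _∸_; _^_; _≤_; _<_; z≤n; s≤s)
open import Data.Nat.Properties
  using (+-comm; +-suc; +-assoc; +-∸-assoc; m+n∸n≡m; *-distribʳ-+; *-identityʳ; ≤-refl; <⇒≤; m<n⇒m<1+n; m≤m+n)
open import Data.Nat.Tactic.RingSolver using (solve-∀)
open import Data.Nat.Solver using (module +-*-Solver)
open +-*-Solver using (solve; _:+_; _:*_; _:^_; _:=_; con)
open import Data.Product using (_×_; _,_)
open import Relation.Binary.PropositionalEquality using (_≡_; refl; sym; trans; cong; cong₂; subst)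
open Relation.Binary.PropositionalEquality.≡-Reasoning

Σ<-cong : ∀ n {f g : ℕ → ℕ} → (∀ i → i < n → f i ≡ g i) → Σ< n f ≡ Σ< n g
Σ<-cong zero    f≡g = refl
Σ<-cong (suc n) f≡g = cong₂ _+_ (Σ<-cong n (λ i i<n → f≡g i (m<n⇒m<1+n i<n))) (f≡g n ≤-refl)

Σ<-+ : ∀ n (f g : ℕ → ℕ) → Σ< n (λ i → f i + g i) ≡ Σ< n f + Σ< n g
Σ<-+ zero    f g = refl
Σ<-+ (suc n) f g = trans (cong (_+ (f n + g n)) (Σ<-+ n f g)) (interchange (Σ< n f) (Σ< n g) (f n) (g n))
  where
  interchange : ∀ x y u v → x + y + (u + v) ≡ x + u + (y + v)
  interchange = solve-∀

Σ<-distribʳ-+ : ∀ n (f g w : ℕ → ℕ) → Σ< n (λ i → (f i + g i) * w i) ≡ Σ< n (λ i → f i * w i) + Σ< n (λ i → g i * w i)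
Σ<-distribʳ-+ n f g w =
  trans (Σ<-cong n (λ i _ → *-distribʳ-+ (w i) (f i) (g i))) (Σ<-+ n (λ i → f i * w i) (λ i → g i * w i))

T-square : ∀ p → T (p + 2) ^ 2 ≡ T (suc (suc p)) * T (suc (suc p))
T-square p = trans (cong (λ q → T q ^ 2) (+-comm p 2)) (cong (T (suc (suc p)) *_) (*-identityʳ _))

conv : ℕ → ℕ → ℕ
conv c p = Σ< p (λ i → T (c + (p ∸ i)) * T (i + 2) ^ 2)

conv-suc : ∀ c p → conv c (suc p) ≡ conv (suc c) p + T (suc c) * T (p + 2) ^ 2
conv-suc c p = cong₂ _+_
  (Σ<-cong p (λ i i<p → cong (λ q → T q * T (i + 2) ^ 2)
    (trans (cong (c +_) (+-∸-assoc 1 (<⇒≤ i<p))) (+-suc c (p ∸ i)))))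
  (cong (λ q → T q * T (p + 2) ^ 2)
    (trans (cong (c +_) (m+n∸n≡m 1 p)) (+-comm c 1)))

conv-rec : ∀ c p → conv (3 + c) p ≡ conv (2 + c) p + conv (1 + c) p + conv c p
conv-rec c p = begin
  conv (3 + c) p                         ≡⟨ Σ<-distribʳ-+ p (λ i → T (2 + c + (p ∸ i)) + T (1 + c + (p ∸ i))) (λ i → T (c + (p ∸ i))) w ⟩
  Σ< p (λ i → (T (2 + c + (p ∸ i)) + T (1 + c + (p ∸ i))) * w i) + conv c p
                                         ≡⟨ cong (_+ conv c p) (Σ<-distribʳ-+ p (λ i → T (2 + c + (p ∸ i))) (λ i → T (1 + c + (p ∸ i))) w) ⟩
  conv (2 + c) p + conv (1 + c) p + conv c p ∎
  where
  w : ℕ → ℕ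
  w i = T (i + 2) ^ 2

conv-closed : ∀ p → let x = T p; y = T (suc p); z = T (suc (suc p)) in
    (2 * conv 1 p ≡ y * y + x * y + y * z)
  × (2 * conv 2 p ≡ x * z + 2 * (y * z))
  × (2 * conv 3 p ≡ y * y + x * y + 2 * (x * z) + 3 * (y * z))
conv-closed zero = refl , refl , refl
conv-closed (suc p) with conv-closed p
... | h₁ , h₂ , h₃ = step₁ , step₂ , step₃
  where
  x y z a : ℕ
  x = T p
  y = T (suc p)
  z = T (suc (suc p))
  a = T (p + 2) ^ 2

  double-+ : ∀ k u → 2 * (k + 1 * u) ≡ 2 * k + 2 * u
  double-+ = solve-∀

  step₁ : 2 * conv 1 (suc p) ≡ z * z + y * z + z * (z + y + x)
  step₁ = begin
    2 * conv 1 (suc p)             ≡⟨ trans (cong (2 *_) (conv-suc 1 p)) (double-+ (conv 2 p) a) ⟩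
    2 * conv 2 p + 2 * a           ≡⟨ cong₂ (λ u v → u + 2 * v) h₂ (T-square p) ⟩
    x * z + 2 * (y * z) + 2 * (z * z) ≡⟨ polynomial x y z ⟩
    z * z + y * z + z * (z + y + x) ∎
    where
    polynomial : ∀ x y z → x * z + 2 * (y * z) + 2 * (z * z) ≡ z * z + y * z + z * (z + y + x)
    polynomial = solve-∀

  step₂ : 2 * conv 2 (suc p) ≡ y * (z + y + x) + 2 * (z * (z + y + x))
  step₂ = begin
    2 * conv 2 (suc p)             ≡⟨ trans (cong (2 *_) (conv-suc 2 p)) (double-+ (conv 3 p) a) ⟩
    2 * conv 3 p + 2 * a           ≡⟨ cong₂ (λ u v → u + 2 * v) h₃ (T-square p) ⟩
    y * y + x * y + 2 * (x * z) + 3 * (y * z) + 2 * (z * z) ≡⟨ polynomial x y z ⟩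
    y * (z + y + x) + 2 * (z * (z + y + x)) ∎
    where
    polynomial : ∀ x y z → y * y + x * y + 2 * (x * z) + 3 * (y * z) + 2 * (z * z) ≡ y * (z + y + x) + 2 * (z * (z + y + x))
    polynomial = solve-∀

  step₃ : 2 * conv 3 (suc p) ≡ z * z + y * z + 2 * (y * (z + y + x)) + 3 * (z * (z + y + x))
  step₃ = begin
    2 * conv 3 (suc p)             ≡⟨ cong (2 *_) (conv-suc 3 p) ⟩
    2 * (conv 4 p + 2 * a)         ≡⟨ cong (λ u → 2 * (u + 2 * a)) (conv-rec 1 p) ⟩
    2 * (conv 3 p + conv 2 p + conv 1 p + 2 * a) ≡⟨ double-+₃ (conv 3 p) (conv 2 p) (conv 1 p) a ⟩
    2 * conv 3 p + 2 * conv 2 p + 2 * conv 1 p + 4 * a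
                                   ≡⟨ cong₂ (λ u v → u + 4 * v) (cong₂ _+_ (cong₂ _+_ h₃ h₂) h₁) (T-square p) ⟩
    y * y + x * y + 2 * (x * z) + 3 * (y * z) + (x * z + 2 * (y * z)) + (y * y + x * y + y * z) + 4 * (z * z)
                                   ≡⟨ polynomial x y z ⟩
    z * z + y * z + 2 * (y * (z + y + x)) + 3 * (z * (z + y + x)) ∎
    where
    double-+₃ : ∀ k₃ k₂ k₁ u → 2 * (k₃ + k₂ + k₁ + 2 * u) ≡ 2 * k₃ + 2 * k₂ + 2 * k₁ + 4 * u
    double-+₃ = solve-∀
    polynomial : ∀ x y z → y * y + x * y + 2 * (x * z) + 3 * (y * z) + (x * z + 2 * (y * z)) + (y * y + x * y + y * z) + 4 * (z * z)
                         ≡ z * z + y * z + 2 * (y * (z + y + x)) + 3 * (z * (z + y + x))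
    polynomial = solve-∀

cross : ℕ → ℕ
cross m = Σ< (m ∸ 3) (λ i → (T (m ∸ i) + T (m ∸ i ∸ 1)) * T (i + 2) ^ 2)

increment : ℕ → ℕ
increment m = T (m + 1) ^ 2 + 2 * T m ^ 2 + 9 * T (m ∸ 1) ^ 2 + 4 * cross m

cross-conv : ∀ p → cross (3 + p) ≡ conv 3 p + conv 2 p
cross-conv p = trans
  (Σ<-cong p (λ i i<p → cong (λ q → (T q + T (q ∸ 1)) * T (i + 2) ^ 2) (+-∸-assoc 3 (<⇒≤ i<p))))
  (Σ<-distribʳ-+ p (λ i → T (3 + (p ∸ i))) (λ i → T (2 + (p ∸ i))) (λ i → T (i + 2) ^ 2))

T-square-step : ∀ m → 2 ≤ m → T (m + 2) ^ 2 ≡ T m ^ 2 + increment m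
T-square-step 0 ()
T-square-step 1 (s≤s ())
T-square-step 2 _ = refl
T-square-step (suc (suc (suc p))) _ with conv-closed p
... | _ , h₂ , h₃ = begin
  T (m + 2) ^ 2                     ≡⟨ cong (λ q → T (3 + q) ^ 2) (+-comm p 2) ⟩
  T (5 + p) ^ 2                     ≡⟨ polynomial x y z ⟩
  T m ^ 2 + (T (4 + p) ^ 2 + 2 * T m ^ 2 + 9 * z ^ 2 + (2 * q₃ + 2 * q₂))
                                    ≡⟨ cong₂ (λ u v → T m ^ 2 + (T (3 + u) ^ 2 + 2 * T m ^ 2 + 9 * z ^ 2 + v)) (+-comm 1 p) (sym four-cross) ⟩
  T m ^ 2 + increment m             ∎
  where
  m x y z q₂ q₃ : ℕ
  m = 3 + p
  x = T p
  y = T (suc p)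
  z = T (suc (suc p))
  q₂ = x * z + 2 * (y * z)
  q₃ = y * y + x * y + 2 * (x * z) + 3 * (y * z)

  four-cross : 4 * cross m ≡ 2 * q₃ + 2 * q₂
  four-cross = begin
    4 * cross m                     ≡⟨ cong (4 *_) (cross-conv p) ⟩
    4 * (conv 3 p + conv 2 p)       ≡⟨ double-double (conv 3 p) (conv 2 p) ⟩
    2 * (2 * conv 3 p) + 2 * (2 * conv 2 p) ≡⟨ cong₂ (λ u v → 2 * u + 2 * v) h₃ h₂ ⟩
    2 * q₃ + 2 * q₂                 ∎
    where
    double-double : ∀ u v → 4 * (u + v) ≡ 2 * (2 * u) + 2 * (2 * v)
    double-double = solve-∀

  -- The reflective solver rejects _^_, so this identity goes through the +-*-Solver.
  polynomial : ∀ x y z → let t₃ = z + y + x; t₄ = t₃ + z + y; t₅ = t₄ + t₃ + z in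
    t₅ ^ 2 ≡ t₃ ^ 2 + (t₄ ^ 2 + 2 * t₃ ^ 2 + 9 * z ^ 2
                       + (2 * (y * y + x * y + 2 * (x * z) + 3 * (y * z)) + 2 * (x * z + 2 * (y * z))))
  polynomial = solve 3 (λ x y z → let t₃ = z :+ y :+ x; t₄ = t₃ :+ z :+ y; t₅ = t₄ :+ t₃ :+ z in
    t₅ :^ 2 := t₃ :^ 2 :+ (t₄ :^ 2 :+ con 2 :* t₃ :^ 2 :+ con 9 :* z :^ 2
                           :+ (con 2 :* (y :* y :+ x :* y :+ con 2 :* (x :* z) :+ con 3 :* (y :* z))
                               :+ con 2 :* (x :* z :+ con 2 :* (y :* z))))) refl

mainTheorem8 : (n j : ℕ) → j ≤ 1 →
    T (2 * (n + 1) + j) ^ 2 ≡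
      1 + Σ1to n (λ k →
        T (2 * k + j + 1) ^ 2 + 2 * T (2 * k + j) ^ 2 + 9 * T (2 * k + j ∸ 1) ^ 2
        + 4 * Σ< (2 * k + j ∸ 3) (λ i →
            (T (2 * k + j ∸ i) + T (2 * k + j ∸ i ∸ 1)) * T (i + 2) ^ 2))
mainTheorem8 zero    .0 z≤n       = refl
mainTheorem8 zero    .1 (s≤s z≤n) = refl
mainTheorem8 (suc n) j  j≤1       = begin
  T (2 * (suc n + 1) + j) ^ 2                       ≡⟨ cong (λ q → T q ^ 2) (shift n j) ⟩
  T (m + 2) ^ 2                                     ≡⟨ T-square-step m 2≤m ⟩
  T m ^ 2 + increment m                             ≡⟨ cong (λ q → T q ^ 2 + increment m) (sym (index n j)) ⟩
  T (2 * (n + 1) + j) ^ 2 + increment m             ≡⟨ cong (_+ increment m) (mainTheorem8 n j j≤1) ⟩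
  1 + Σ1to n (λ k → increment (2 * k + j)) + increment m ≡⟨ +-assoc 1 (Σ1to n (λ k → increment (2 * k + j))) (increment m) ⟩
  1 + Σ1to (suc n) (λ k → increment (2 * k + j))   ∎
  where
  m : ℕ
  m = 2 * suc n + j
  2≤m : 2 ≤ m
  2≤m = subst (2 ≤_) (sym (m-as-sum n j)) (m≤m+n 2 (2 * n + j))
    where
    m-as-sum : ∀ n j → 2 * suc n + j ≡ 2 + (2 * n + j)
    m-as-sum = solve-∀
  shift : ∀ n j → 2 * (suc n + 1) + j ≡ 2 * suc n + j + 2
  shift = solve-∀
  index : ∀ n j → 2 * (n + 1) + j ≡ 2 * suc n + j
  index = solve-∀
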